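{- Let $q>1$ be a square-free integer, and let $c$ be a prime. If $x,y,a,b$ are integers with $x^2+qy^2=c^2=a^2+qb^2$ and $abxy\neq 0$, then $(x,y)=(h_1a,h_2b)$ for some $h_1,h_2\in\{1,-1\}$. -}

module Defs where

open import Data.Nat using (ℕ; _*_)
open import Data.Nat.Divisibility using (_∣_)
open import Data.Nat.Primality using (Prime)
open import Data.Empty using (⊥)

SquareFree : ℕ → Set
SquareFree q = ∀ p → Prime p → (p * p) ∣ q → ⊥

{-# OPTIONS --safe #-}
-- Write P = x b − y a and R = x b + y a. Then P R = (b² − y²) c², and Brahmagupta's identity
-- gives (x a + q y b)² + q P² = c⁴; as q > 1 this leaves |P| < c² unless P = 0, so c² ∣ P
-- forces P = 0 and hence |y| = |b|. The prime c divides P R. It divides both factors only if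
-- c = 2: otherwise it divides P + R = 2 x b, but 0 < |y|, |b| < c gives c ∤ y, b, and then
-- c ∤ x since c² ∤ q; for c = 2 the same bounds give |y| = |b| = 1. If c divides only P,
-- then c² ∣ P; if it divides only R, replacing a by −a swaps P and R.
module Submission where

open import Defs
open import Data.Nat using (ℕ; _<_)
open import Data.Nat.Primality using (Prime)
open import Data.Integer using (ℤ; +_; _+_; _*_; -_; 1ℤ; -1ℤ)
open import Data.Product using (∃₂; _×_)
open import Data.Sum using (_⊎_)
open import Relation.Binary.PropositionalEquality using (_≡_; _≢_)

import Data.Nat as ℕ
open import Data.Nat using (zero; suc)
import Data.Nat.Properties as ℕ
open import Data.Nat.Divisibility using (_∣_; _∣?_; divides; ∣⇒≤; ∣-refl; ∣-trans; *-pres-∣; *-monoˡ-∣; *-cancelˡ-∣; ∣m+n∣m⇒∣n; n∣m*n)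
open import Data.Nat.Primality using (euclidsLemma; prime⇒nonZero)
open import Data.Integer using (∣_∣; _-_; 0ℤ; -[1+_])
open import Data.Integer.Properties using (+-injective; pos-+; pos-*; +◃n≡+n; abs-*; ∣i∣≡0⇒i≡0; i-j≡0⇒i≡j; *-zeroʳ; *-identityˡ; -1*i≡-i)
import Data.Integer.Divisibility.Signed as Signed
open import Data.Integer.Tactic.RingSolver using (solve-∀)
open import Data.Product using (∃; _,_)
open import Data.Sum using (inj₁; inj₂; [_,_]′)
open import Data.Empty using (⊥-elim)
open import Relation.Nullary using (¬_; yes; no; contradiction)
open import Relation.Binary.Definitions using (tri<; tri≈; tri>)
open import Relation.Binary.PropositionalEquality using (refl; sym; trans; cong; cong₂; subst; module ≡-Reasoning)

private
  variable
    m n p q u : ℕ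
    x y : ℤ

m*m<n*n⇒m<n : m ℕ.* m < n ℕ.* n → m < n
m*m<n*n⇒m<n mm<nn = ℕ.≰⇒> (λ n≤m → ℕ.<⇒≱ mm<nn (ℕ.*-mono-≤ n≤m n≤m))

m*m≡n*n⇒m≡n : m ℕ.* m ≡ n ℕ.* n → m ≡ n
m*m≡n*n⇒m≡n {m} {n} mm≡nn with ℕ.<-cmp m n
... | tri< m<n _ _ = contradiction mm≡nn (ℕ.<⇒≢ (ℕ.*-mono-< m<n m<n))
... | tri≈ _ m≡n _ = m≡n
... | tri> _ _ n<m = contradiction (sym mm≡nn) (ℕ.<⇒≢ (ℕ.*-mono-< n<m n<m))

u+q*m*m≡n*n⇒m<n : 1 < q → m ≢ 0 → u ℕ.+ q ℕ.* (m ℕ.* m) ≡ n ℕ.* n → m < n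
u+q*m*m≡n*n⇒m<n {q} {m} {u} {n} 1<q m≢0 eq = m*m<n*n⇒m<n (begin-strict
  m ℕ.* m                     <⟨ ℕ.m<m*n (m ℕ.* m) q 1<q ⟩
  m ℕ.* m ℕ.* q               ≡⟨ ℕ.*-comm (m ℕ.* m) q ⟩
  q ℕ.* (m ℕ.* m)             ≤⟨ ℕ.m≤n+m _ u ⟩
  u ℕ.+ q ℕ.* (m ℕ.* m)       ≡⟨ eq ⟩
  n ℕ.* n                     ∎)
  where
  open ℕ.≤-Reasoning
  instance
    _ = ℕ.≢-nonZero m≢0
    _ = ℕ.m*n≢0 m m

u+q*m*m≡n*n∧n∣m⇒m≡0 : 1 < q → n ∣ m → u ℕ.+ q ℕ.* (m ℕ.* m) ≡ n ℕ.* n → m ≡ 0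
u+q*m*m≡n*n∧n∣m⇒m≡0 {m = zero}  _   _   _  = refl
u+q*m*m≡n*n∧n∣m⇒m≡0 {m = suc _} 1<q n∣m eq =
  contradiction (∣⇒≤ n∣m) (ℕ.<⇒≱ (u+q*m*m≡n*n⇒m<n 1<q (λ ()) eq))

p*p∣m*n∧p∤n⇒p*p∣m : Prime p → ¬ p ∣ n → p ℕ.* p ∣ m ℕ.* n → p ℕ.* p ∣ m
p*p∣m*n∧p∤n⇒p*p∣m {p} {n} {m} p-prime p∤n pp∣mn
  with euclidsLemma m n p-prime (∣-trans (n∣m*n p) pp∣mn)
... | inj₂ p∣n = contradiction p∣n p∤n
... | inj₁ (divides k refl) with euclidsLemma k n p-prime p∣kn
  where
  instance _ = prime⇒nonZero p-prime
  p∣kn : p ∣ k ℕ.* n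
  p∣kn = *-cancelˡ-∣ p (subst (p ℕ.* p ∣_) (trans (cong (ℕ._* n) (ℕ.*-comm k p)) (ℕ.*-assoc p k n)) pp∣mn)
...   | inj₁ p∣k = *-monoˡ-∣ p p∣k
...   | inj₂ p∣n = contradiction p∣n p∤n

u+q*m*m≡p*p⇒p∤m : 1 < q → m ≢ 0 → u ℕ.+ q ℕ.* (m ℕ.* m) ≡ p ℕ.* p → ¬ p ∣ m
u+q*m*m≡p*p⇒p∤m 1<q m≢0 eq p∣m = m≢0 (u+q*m*m≡n*n∧n∣m⇒m≡0 1<q p∣m eq)

n*n+q*m*m≡p*p⇒p∤n : 1 < q → SquareFree q → Prime p → m ≢ 0 →
              n ℕ.* n ℕ.+ q ℕ.* (m ℕ.* m) ≡ p ℕ.* p → ¬ p ∣ n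
n*n+q*m*m≡p*p⇒p∤n {q} {p} {m} {n} 1<q q-squarefree p-prime m≢0 eq p∣n =
  q-squarefree p p-prime (p*p∣m*n∧p∤n⇒p*p∣m p-prime p∤m*m pp∣qmm)
  where
  pp∣qmm : p ℕ.* p ∣ q ℕ.* (m ℕ.* m)
  pp∣qmm = ∣m+n∣m⇒∣n (subst (p ℕ.* p ∣_) (sym eq) ∣-refl) (*-pres-∣ p∣n p∣n)
  p∤m*m : ¬ p ∣ m ℕ.* m
  p∤m*m p∣mm with euclidsLemma m m p-prime p∣mm
  ... | inj₁ p∣m = u+q*m*m≡p*p⇒p∤m 1<q m≢0 eq p∣m
  ... | inj₂ p∣m = u+q*m*m≡p*p⇒p∤m 1<q m≢0 eq p∣m

i*i≡+∣i∣*∣i∣ : ∀ i → i * i ≡ + (∣ i ∣ ℕ.* ∣ i ∣)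
i*i≡+∣i∣*∣i∣ (+ n)    = sym (pos-* n n)
i*i≡+∣i∣*∣i∣ -[1+ n ] = +◃n≡+n _

abs-form : x * x + + q * (y * y) ≡ + n * + n →
           ∣ x ∣ ℕ.* ∣ x ∣ ℕ.+ q ℕ.* (∣ y ∣ ℕ.* ∣ y ∣) ≡ n ℕ.* n
abs-form {x} {q} {y} {n} eq = +-injective (begin
  + (∣ x ∣ ℕ.* ∣ x ∣ ℕ.+ q ℕ.* (∣ y ∣ ℕ.* ∣ y ∣))     ≡⟨ pos-+ (∣ x ∣ ℕ.* ∣ x ∣) _ ⟩
  + (∣ x ∣ ℕ.* ∣ x ∣) + + (q ℕ.* (∣ y ∣ ℕ.* ∣ y ∣))   ≡⟨ cong (_+_ (+ (∣ x ∣ ℕ.* ∣ x ∣))) (pos-* q _) ⟩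
  + (∣ x ∣ ℕ.* ∣ x ∣) + + q * + (∣ y ∣ ℕ.* ∣ y ∣)     ≡⟨ cong₂ (λ s t → s + + q * t) (i*i≡+∣i∣*∣i∣ x) (i*i≡+∣i∣*∣i∣ y) ⟨
  x * x + + q * (y * y)                               ≡⟨ eq ⟩
  + n * + n                                           ≡⟨ pos-* n n ⟨
  + (n ℕ.* n)                                         ∎)
  where open ≡-Reasoning

difference-of-squares-identity : ∀ x y a b Q →
  (x * b - y * a) * (x * b + y * a) ≡ b * b * (x * x + Q * (y * y)) - y * y * (a * a + Q * (b * b))
difference-of-squares-identity = solve-∀

brahmagupta-identity : ∀ x y a b Q →
  (x * x + Q * (y * y)) * (a * a + Q * (b * b)) ≡
  (x * a + Q * (y * b)) * (x * a + Q * (y * b)) + Q * ((x * b - y * a) * (x * b - y * a))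
brahmagupta-identity = solve-∀

module TwoRepresentations
  (q c : ℕ) (1<q : 1 < q) (q-squarefree : SquareFree q) (c-prime : Prime c)
  (x y a b : ℤ) (∣y∣≢0 : ∣ y ∣ ≢ 0) (∣b∣≢0 : ∣ b ∣ ≢ 0)
  (eqx : x * x + + q * (y * y) ≡ + c * + c) (eqa : a * a + + q * (b * b) ≡ + c * + c)
  where

  P R U : ℤ
  P = x * b - y * a
  R = x * b + y * a
  U = x * a + + q * (y * b)

  ∣x∣*∣x∣+q*∣y∣*∣y∣≡c*c : ∣ x ∣ ℕ.* ∣ x ∣ ℕ.+ q ℕ.* (∣ y ∣ ℕ.* ∣ y ∣) ≡ c ℕ.* c
  ∣x∣*∣x∣+q*∣y∣*∣y∣≡c*c = abs-form {x} {q} {y} {c} eqx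

  ∣a∣*∣a∣+q*∣b∣*∣b∣≡c*c : ∣ a ∣ ℕ.* ∣ a ∣ ℕ.+ q ℕ.* (∣ b ∣ ℕ.* ∣ b ∣) ≡ c ℕ.* c
  ∣a∣*∣a∣+q*∣b∣*∣b∣≡c*c = abs-form {a} {q} {b} {c} eqa

  ∣P∣*∣R∣≡∣b*b-y*y∣*c*c : ∣ P ∣ ℕ.* ∣ R ∣ ≡ ∣ b * b - y * y ∣ ℕ.* (c ℕ.* c)
  ∣P∣*∣R∣≡∣b*b-y*y∣*c*c = begin
    ∣ P ∣ ℕ.* ∣ R ∣                                                     ≡⟨ abs-* P R ⟨
    ∣ P * R ∣                                                           ≡⟨ cong ∣_∣ (difference-of-squares-identity x y a b (+ q)) ⟩
    ∣ b * b * (x * x + + q * (y * y)) - y * y * (a * a + + q * (b * b)) ∣ ≡⟨ cong ∣_∣ (cong₂ (λ s t → b * b * s - y * y * t) eqx eqa) ⟩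
    ∣ b * b * (+ c * + c) - y * y * (+ c * + c) ∣                       ≡⟨ cong ∣_∣ (factor (b * b) (y * y) (+ c * + c)) ⟩
    ∣ (b * b - y * y) * (+ c * + c) ∣                                   ≡⟨ abs-* (b * b - y * y) _ ⟩
    ∣ b * b - y * y ∣ ℕ.* ∣ + c * + c ∣                                 ≡⟨ cong (∣ b * b - y * y ∣ ℕ.*_) (abs-* (+ c) (+ c)) ⟩
    ∣ b * b - y * y ∣ ℕ.* (c ℕ.* c)                                     ∎
    where
    open ≡-Reasoning
    factor : ∀ i j k → i * k - j * k ≡ (i - j) * k
    factor = solve-∀

  c*c∣∣P∣*∣R∣ : c ℕ.* c ∣ ∣ P ∣ ℕ.* ∣ R ∣
  c*c∣∣P∣*∣R∣ = divides ∣ b * b - y * y ∣ ∣P∣*∣R∣≡∣b*b-y*y∣*c*c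

  ∣U∣*∣U∣+q*∣P∣*∣P∣≡c*c*c*c : ∣ U ∣ ℕ.* ∣ U ∣ ℕ.+ q ℕ.* (∣ P ∣ ℕ.* ∣ P ∣) ≡ (c ℕ.* c) ℕ.* (c ℕ.* c)
  ∣U∣*∣U∣+q*∣P∣*∣P∣≡c*c*c*c = abs-form {U} {q} {P} {c ℕ.* c} (begin
    U * U + + q * (P * P)                               ≡⟨ brahmagupta-identity x y a b (+ q) ⟨
    (x * x + + q * (y * y)) * (a * a + + q * (b * b))   ≡⟨ cong₂ _*_ eqx eqa ⟩
    (+ c * + c) * (+ c * + c)                           ≡⟨ cong₂ _*_ (pos-* c c) (pos-* c c) ⟨
    + (c ℕ.* c) * + (c ℕ.* c)                           ∎)
    where open ≡-Reasoning

  c*c∣P⇒∣y∣≡∣b∣ : c ℕ.* c ∣ ∣ P ∣ → ∣ y ∣ ≡ ∣ b ∣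
  c*c∣P⇒∣y∣≡∣b∣ c*c∣P = sym (m*m≡n*n⇒m≡n (begin
    ∣ b ∣ ℕ.* ∣ b ∣   ≡⟨ abs-* b b ⟨
    ∣ b * b ∣         ≡⟨ cong ∣_∣ (i-j≡0⇒i≡j (b * b) (y * y) (∣i∣≡0⇒i≡0 ∣b*b-y*y∣≡0)) ⟩
    ∣ y * y ∣         ≡⟨ abs-* y y ⟩
    ∣ y ∣ ℕ.* ∣ y ∣   ∎))
    where
    open ≡-Reasoning
    instance
      _ = prime⇒nonZero c-prime
      _ = ℕ.m*n≢0 c c
    ∣P∣≡0 : ∣ P ∣ ≡ 0
    ∣P∣≡0 = u+q*m*m≡n*n∧n∣m⇒m≡0 1<q c*c∣P ∣U∣*∣U∣+q*∣P∣*∣P∣≡c*c*c*c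
    ∣b*b-y*y∣≡0 : ∣ b * b - y * y ∣ ≡ 0
    ∣b*b-y*y∣≡0 = ℕ.m*n≡0⇒m≡0 _ (c ℕ.* c) (trans (sym ∣P∣*∣R∣≡∣b*b-y*y∣*c*c) (cong (ℕ._* ∣ R ∣) ∣P∣≡0))

  c∣P∧c∣R⇒∣y∣≡∣b∣ : c ∣ ∣ P ∣ → c ∣ ∣ R ∣ → ∣ y ∣ ≡ ∣ b ∣
  c∣P∧c∣R⇒∣y∣≡∣b∣ c∣P c∣R with euclidsLemma 2 (∣ x ∣ ℕ.* ∣ b ∣) c-prime c∣2*∣x∣*∣b∣
    where
    P+R≡2*x*b : ∀ x y a b → x * b - y * a + (x * b + y * a) ≡ + 2 * (x * b)
    P+R≡2*x*b = solve-∀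
    c∣2*∣x∣*∣b∣ : c ∣ 2 ℕ.* (∣ x ∣ ℕ.* ∣ b ∣)
    c∣2*∣x∣*∣b∣ = subst (c ∣_)
      (trans (cong ∣_∣ (P+R≡2*x*b x y a b)) (trans (abs-* (+ 2) (x * b)) (cong (2 ℕ.*_) (abs-* x b))))
      (Signed.∣⇒∣ᵤ (Signed.∣m∣n⇒∣m+n (Signed.∣ᵤ⇒∣ {+ c} {P} c∣P) (Signed.∣ᵤ⇒∣ {+ c} {R} c∣R)))
  ... | inj₁ c∣2 = trans (m≢0∧m<c⇒m≡1 ∣y∣≢0 (u+q*m*m≡n*n⇒m<n 1<q ∣y∣≢0 ∣x∣*∣x∣+q*∣y∣*∣y∣≡c*c))
                     (sym (m≢0∧m<c⇒m≡1 ∣b∣≢0 (u+q*m*m≡n*n⇒m<n 1<q ∣b∣≢0 ∣a∣*∣a∣+q*∣b∣*∣b∣≡c*c)))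
    where
    m≢0∧m<c⇒m≡1 : m ≢ 0 → m < c → m ≡ 1
    m≢0∧m<c⇒m≡1 m≢0 m<c = ℕ.≤-antisym (ℕ.≤-pred (ℕ.<-≤-trans m<c (∣⇒≤ c∣2))) (ℕ.n≢0⇒n>0 m≢0)
  ... | inj₂ c∣∣x∣*∣b∣ with euclidsLemma ∣ x ∣ ∣ b ∣ c-prime c∣∣x∣*∣b∣
  ...   | inj₁ c∣x = ⊥-elim (n*n+q*m*m≡p*p⇒p∤n 1<q q-squarefree c-prime ∣y∣≢0 ∣x∣*∣x∣+q*∣y∣*∣y∣≡c*c c∣x)
  ...   | inj₂ c∣b = ⊥-elim (u+q*m*m≡p*p⇒p∤m 1<q ∣b∣≢0 ∣a∣*∣a∣+q*∣b∣*∣b∣≡c*c c∣b)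

  c∣P⇒∣y∣≡∣b∣ : c ∣ ∣ P ∣ → ∣ y ∣ ≡ ∣ b ∣
  c∣P⇒∣y∣≡∣b∣ c∣P with c ∣? ∣ R ∣
  ... | yes c∣R = c∣P∧c∣R⇒∣y∣≡∣b∣ c∣P c∣R
  ... | no c∤R  = c*c∣P⇒∣y∣≡∣b∣ (p*p∣m*n∧p∤n⇒p*p∣m c-prime c∤R c*c∣∣P∣*∣R∣)
  ∣y∣≡∣b∣⇒∣x∣≡∣a∣ : ∣ y ∣ ≡ ∣ b ∣ → ∣ x ∣ ≡ ∣ a ∣
  ∣y∣≡∣b∣⇒∣x∣≡∣a∣ ∣y∣≡∣b∣ = m*m≡n*n⇒m≡n (ℕ.+-cancelʳ-≡ (q ℕ.* (∣ y ∣ ℕ.* ∣ y ∣)) _ _ (begin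
    ∣ x ∣ ℕ.* ∣ x ∣ ℕ.+ q ℕ.* (∣ y ∣ ℕ.* ∣ y ∣)   ≡⟨ ∣x∣*∣x∣+q*∣y∣*∣y∣≡c*c ⟩
    c ℕ.* c                                     ≡⟨ ∣a∣*∣a∣+q*∣b∣*∣b∣≡c*c ⟨
    ∣ a ∣ ℕ.* ∣ a ∣ ℕ.+ q ℕ.* (∣ b ∣ ℕ.* ∣ b ∣)   ≡⟨ cong (λ t → ∣ a ∣ ℕ.* ∣ a ∣ ℕ.+ q ℕ.* (t ℕ.* t)) ∣y∣≡∣b∣ ⟨
    ∣ a ∣ ℕ.* ∣ a ∣ ℕ.+ q ℕ.* (∣ y ∣ ℕ.* ∣ y ∣)   ∎))
    where open ≡-Reasoning

prime-square-representations⇒∣y∣≡∣b∣ :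
  (q c : ℕ) → 1 < q → SquareFree q → Prime c → (x y a b : ℤ) → ∣ y ∣ ≢ 0 → ∣ b ∣ ≢ 0 →
  x * x + + q * (y * y) ≡ + c * + c → a * a + + q * (b * b) ≡ + c * + c → ∣ y ∣ ≡ ∣ b ∣
prime-square-representations⇒∣y∣≡∣b∣ q c 1<q q-squarefree c-prime x y a b ∣y∣≢0 ∣b∣≢0 eqx eqa =
  [ T.c∣P⇒∣y∣≡∣b∣ , (λ c∣R → T⁻.c∣P⇒∣y∣≡∣b∣ (subst (c ∣_) (cong ∣_∣ (R≡P[a≔-a] x y a b)) c∣R)) ]′
    (euclidsLemma ∣ T.P ∣ ∣ T.R ∣ c-prime (∣-trans (n∣m*n c) T.c*c∣∣P∣*∣R∣))
  where
  square-neg : ∀ a → - a * - a ≡ a * a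
  square-neg = solve-∀
  R≡P[a≔-a] : ∀ x y a b → x * b + y * a ≡ x * b - y * (- a)
  R≡P[a≔-a] = solve-∀
  module T  = TwoRepresentations q c 1<q q-squarefree c-prime x y a b ∣y∣≢0 ∣b∣≢0 eqx eqa
  module T⁻ = TwoRepresentations q c 1<q q-squarefree c-prime x y (- a) b ∣y∣≢0 ∣b∣≢0 eqx
                (trans (cong (_+ + q * (b * b)) (square-neg a)) eqa)

∣i∣≡∣j∣⇒i≡±j : ∀ i j → ∣ i ∣ ≡ ∣ j ∣ → ∃ λ h → (h ≡ 1ℤ ⊎ h ≡ -1ℤ) × i ≡ h * j
∣i∣≡∣j∣⇒i≡±j (+ _)      (+ _)      refl = 1ℤ , inj₁ refl , sym (*-identityˡ _)
∣i∣≡∣j∣⇒i≡±j -[1+ _ ]   -[1+ _ ]   refl = 1ℤ , inj₁ refl , sym (*-identityˡ _)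
∣i∣≡∣j∣⇒i≡±j (+ _)      -[1+ n ]   refl = -1ℤ , inj₂ refl , sym (-1*i≡-i -[1+ n ])
∣i∣≡∣j∣⇒i≡±j -[1+ m ]   (+ _)      refl = -1ℤ , inj₂ refl , sym (-1*i≡-i (+ suc m))

a*b*x*y≢0⇒∣b∣≢0 : ∀ a b x y → a * b * x * y ≢ 0ℤ → ∣ b ∣ ≢ 0
a*b*x*y≢0⇒∣b∣≢0 a b x y abxy≢0 ∣b∣≡0 = abxy≢0 (begin
  a * b * x * y    ≡⟨ cong (λ t → a * t * x * y) (∣i∣≡0⇒i≡0 ∣b∣≡0) ⟩
  a * 0ℤ * x * y   ≡⟨ cong (λ t → t * x * y) (*-zeroʳ a) ⟩
  0ℤ               ∎)
  where open ≡-Reasoning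

a*b*x*y≢0⇒∣y∣≢0 : ∀ a b x y → a * b * x * y ≢ 0ℤ → ∣ y ∣ ≢ 0
a*b*x*y≢0⇒∣y∣≢0 a b x y abxy≢0 ∣y∣≡0 =
  abxy≢0 (trans (cong (a * b * x *_) (∣i∣≡0⇒i≡0 ∣y∣≡0)) (*-zeroʳ (a * b * x)))

claim1 : (q c : ℕ) → 1 < q → SquareFree q → Prime c →
           (x y a b : ℤ) →
           x * x + (+ q) * (y * y) ≡ (+ c) * (+ c) →
           a * a + (+ q) * (b * b) ≡ (+ c) * (+ c) →
           a * b * x * y ≢ + 0 →
           ∃₂ λ (h₁ h₂ : ℤ) → (h₁ ≡ 1ℤ ⊎ h₁ ≡ -1ℤ) × (h₂ ≡ 1ℤ ⊎ h₂ ≡ -1ℤ) ×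
             x ≡ h₁ * a × y ≡ h₂ * b
claim1 q c 1<q q-squarefree c-prime x y a b eqx eqa abxy≢0 =
  let h₁ , h₁-unit , x≡h₁a = ∣i∣≡∣j∣⇒i≡±j x a ∣x∣≡∣a∣
      h₂ , h₂-unit , y≡h₂b = ∣i∣≡∣j∣⇒i≡±j y b ∣y∣≡∣b∣
  in h₁ , h₂ , h₁-unit , h₂-unit , x≡h₁a , y≡h₂b
  where
  ∣y∣≢0 : ∣ y ∣ ≢ 0
  ∣y∣≢0 = a*b*x*y≢0⇒∣y∣≢0 a b x y abxy≢0
  ∣b∣≢0 : ∣ b ∣ ≢ 0
  ∣b∣≢0 = a*b*x*y≢0⇒∣b∣≢0 a b x y abxy≢0
  module T = TwoRepresentations q c 1<q q-squarefree c-prime x y a b ∣y∣≢0 ∣b∣≢0 eqx eqa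
  ∣y∣≡∣b∣ : ∣ y ∣ ≡ ∣ b ∣
  ∣y∣≡∣b∣ = prime-square-representations⇒∣y∣≡∣b∣ q c 1<q q-squarefree c-prime x y a b ∣y∣≢0 ∣b∣≢0 eqx eqa
  ∣x∣≡∣a∣ : ∣ x ∣ ≡ ∣ a ∣
  ∣x∣≡∣a∣ = T.∣y∣≡∣b∣⇒∣x∣≡∣a∣ ∣y∣≡∣b∣
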